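{- 1. Let $\mathcal{C}$ be a finite set of constraints and let $S$ and $U$ be sets of constraint applications of $\mathcal{C}$ with constants. Then $S$ is isomorphic to $U$ if and only if $S$ isomorphically implies $U$ and $U$ isomorphically implies $S$. 2. For graphs $G$ and $H$ without isolated vertices, $G$ contains a subgraph isomorphic to $H$ if and only if $S(G)$ isomorphically implies $S(H)$, where for a graph $\widehat G$, $S(\widehat G)=\{x_i\vee x_j : \{i,j\}\in E(\widehat G)\}$.
   Context: A constraint of arity $k$ is a Boolean function $\{0,1\}^k\to\{0,1\}$; a constraint application with constants is $C(z_1,\ldots,z_k)$ with each $z_i$ a variable or constant $0/1$; a set of constraint applications is read as the conjunction of its elements. Let $X$ be the set of variables occurring in $S\cup U$. $S$ is isomorphic to $U$ if there is a permutation $\pi$ of $X$ with $\pi(S)\equiv U$ (logically equivalent), where $\pi(S)$ replaces each variable $x$ simultaneously by $\pi(x)$. $S$ isomorphically implies $U$ if there is a permutation $\pi$ of $X$ with $\pi(S)\Rightarrow U$. A graph $G$ contains a subgraph isomorphic to $H$ if there is a graph $G'$ with $V(G')\subseteq V(G)$, $E(G')\subseteq E(G)$ and $G'$ isomorphic to $H$. -}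

module Defs where

open import Data.Nat using (ℕ)
open import Data.Empty using (⊥)
open import Data.Bool using (Bool; true; false; _∨_)
open import Data.Vec using (Vec; []; _∷_; foldr)
import Data.Vec as Vec
open import Data.List using (List; []; _∷_; _++_; concatMap)
import Data.List as List
open import Data.List.Membership.Propositional using (_∈_)
open import Data.List.Relation.Unary.All using (All)
open import Data.List.Relation.Unary.Any using (Any)
open import Data.Product using (Σ; _×_; _,_; ∃)
open import Data.Sum using (_⊎_)
open import Relation.Binary.PropositionalEquality using (_≡_; _≢_)
open import Relation.Nullary using (¬_)
open import Function.Bundles using (_↔_; Inverse)

record Constraint : Set where
  constructor mkConstraint
  field
    arity : ℕ
    fn    : Vec Bool arity → Bool
open Constraint public

data Term : Set where
  var   : ℕ → Term
  const : Bool → Term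

record App : Set where
  constructor app
  field
    con  : Constraint
    args : Vec Term (arity con)
open App public

Apps : Set
Apps = List App

AppsOf : List Constraint → Apps → Set
AppsOf 𝒞 S = All (λ a → con a ∈ 𝒞) S

Assignment : Set
Assignment = ℕ → Bool

evalTerm : Assignment → Term → Bool
evalTerm α (var x)   = α x
evalTerm α (const b) = b

satApp : Assignment → App → Bool
satApp α (app c zs) = fn c (Vec.map (evalTerm α) zs)

Sat : Assignment → Apps → Set
Sat α S = All (λ a → satApp α a ≡ true) S

_≡ₗ_ : Apps → Apps → Set
S ≡ₗ U = ∀ (α : Assignment) → (Sat α S → Sat α U) × (Sat α U → Sat α S)

_⇒ₗ_ : Apps → Apps → Set
S ⇒ₗ U = ∀ (α : Assignment) → Sat α S → Sat α U

OccursT : ℕ → Term → Set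
OccursT x (var y)   = x ≡ y
OccursT x (const b) = ⊥

OccursApp : ℕ → App → Set
OccursApp x a = Data.Vec.Relation.Unary.Any.Any (OccursT x) (args a)
  where import Data.Vec.Relation.Unary.Any

Occurs : ℕ → Apps → Set
Occurs x S = Any (OccursApp x) S

renameT : (ℕ → ℕ) → Term → Term
renameT π (var x)   = var (π x)
renameT π (const b) = const b

renameApp : (ℕ → ℕ) → App → App
renameApp π (app c zs) = app c (Vec.map (renameT π) zs)

rename : (ℕ → ℕ) → Apps → Apps
rename π S = List.map (renameApp π) S

-- A permutation of X = variables occurring in S ∪ U, represented as a
-- bijection of ℕ that is the identity outside X.
PermOf : Apps → Apps → Set
PermOf S U = Σ (ℕ ↔ ℕ) λ π →
  ∀ x → ¬ Occurs x (S ++ U) → Inverse.to π x ≡ x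

IsoApps : Apps → Apps → Set
IsoApps S U = Σ (PermOf S U) λ p → rename (Inverse.to (Data.Product.proj₁ p)) S ≡ₗ U

IsoImplies : Apps → Apps → Set
IsoImplies S U = Σ (PermOf S U) λ p → rename (Inverse.to (Data.Product.proj₁ p)) S ⇒ₗ U

record Graph : Set where
  field
    V        : List ℕ
    E        : List (ℕ × ℕ)     -- each pair (i , j) is the unordered edge {i,j}
    edgesInV : All (λ e → (Data.Product.proj₁ e ∈ V) × (Data.Product.proj₂ e ∈ V)) E
    loopless : All (λ e → Data.Product.proj₁ e ≢ Data.Product.proj₂ e) E
open Graph public

Adj : Graph → ℕ → ℕ → Set
Adj G i j = ((i , j) ∈ E G) ⊎ ((j , i) ∈ E G)

NoIsolated : Graph → Set
NoIsolated G = ∀ v → v ∈ V G → ∃ λ u → Adj G v u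

GraphIso : Graph → Graph → Set
GraphIso G H = Σ (ℕ → ℕ) λ f → Σ (ℕ → ℕ) λ g →
    (∀ v → v ∈ V G → f v ∈ V H)
  × (∀ w → w ∈ V H → g w ∈ V G)
  × (∀ v → v ∈ V G → g (f v) ≡ v)
  × (∀ w → w ∈ V H → f (g w) ≡ w)
  × (∀ u v → u ∈ V G → v ∈ V G → (Adj G u v → Adj H (f u) (f v)) × (Adj H (f u) (f v) → Adj G u v))

ContainsSubgraph : Graph → Graph → Set
ContainsSubgraph G H = Σ Graph λ G' →
    (∀ v → v ∈ V G' → v ∈ V G)
  × (∀ i j → Adj G' i j → Adj G i j)
  × GraphIso G' H

orFn : Vec Bool 2 → Bool
orFn (a ∷ b ∷ []) = a ∨ b

OR : Constraint
OR = mkConstraint 2 orFn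

S[_] : Graph → Apps
S[ G ] = List.map (λ e → app OR (var (Data.Product.proj₁ e) ∷ var (Data.Product.proj₂ e) ∷ [])) (E G)

-- Part 1: if π S ⇒ U and σ U ⇒ S, then τ = σ ∘ π satisfies τ S ⇒ S. As τ permutes the
-- finitely many variables of S ∪ U and fixes all others, τᵐ = id for some m > 0, and
-- applying τ to τᵐ⁻¹ S ⇒ S gives S ⇒ τ S; hence U ⇒ σ⁻¹ S ⇒ σ⁻¹ τ S = π S.
-- Part 2: an isomorphism from a subgraph G' ⊆ G onto H extends, by transpositions, to a
-- permutation ρ of the vertices of G' and H, and every clause of S(H) is then a clause of
-- ρ S(G). Conversely, if π S(G) ⇒ S(H), then for each edge {a,b} of H the assignment that
-- is false exactly on a and b falsifies S(H), hence some clause x_πi ∨ x_πj with {i,j} an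
-- edge of G, which forces {πi,πj} = {a,b}; so π⁻¹ embeds H into G.
module Submission where

open import Defs
open import Data.Bool using (true; false; _∨_)
open import Data.Bool.Properties using (∨-comm) renaming (_≟_ to _≟ᵇ_)
open import Data.Empty using (⊥-elim)
open import Data.Fin using (toℕ)
open import Data.Fin.Properties using (pigeonhole)
open import Data.List using (List; []; _∷_; _++_; length; filter)
import Data.List as List
import Data.List.Properties as List
open import Data.List.Membership.Propositional using (_∈_; _∉_; find; lose)
open import Data.List.Membership.Propositional.Properties
  using (∈-++⁺ˡ; ∈-++⁺ʳ; ∈-++⁻; ∈-map⁺; ∈-map⁻; ∈-filter⁺; ∈-filter⁻)
open import Data.List.Membership.Setoid.Properties using (index-injective)
open import Data.List.Relation.Unary.All using (All)
import Data.List.Relation.Unary.All as All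
import Data.List.Relation.Unary.All.Properties as All
open import Data.List.Relation.Unary.Any using (Any; here; there; index; any?)
import Data.List.Relation.Unary.Any.Properties as Any
open import Data.Nat using (ℕ; zero; suc; _+_; _*_; _≟_)
open import Data.List.Membership.DecPropositional _≟_ using (_∈?_)
open import Data.Nat.GeneralisedArithmetic using (fold; fold-+)
open import Data.Nat.Properties using (+-suc; *-comm; m≤n⇒∃[o]m+o≡n; n<1+n)
open import Data.Product using (∃; ∃₂; _×_; _,_; proj₁; proj₂)
open import Data.Product.Properties using (≡-dec)
open import Data.List.Membership.DecPropositional (≡-dec _≟_ _≟_) using () renaming (_∈?_ to _∈ₑ?_)
import Data.Product
open import Data.Sum using (_⊎_; inj₁; inj₂; [_,_]′)
import Data.Sum
open import Data.Vec using (Vec; []; _∷_)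
import Data.Vec as Vec
import Data.Vec.Properties as Vec
import Data.Vec.Relation.Unary.Any as VAny
open import Function using (_∘_; id; _↔_; Inverse; _⇔_; mk⇔; mk↔ₛ′)
open import Function.Bundles using (Injection)
open import Function.Properties.Inverse using (↔-refl; ↔-sym; ↔-trans; ↔⇒↣)
open import Relation.Binary.Bundles using (Preorder)
import Relation.Binary.Reasoning.Preorder
open import Relation.Binary.PropositionalEquality
open import Relation.Nullary using (¬_; yes; no; Dec; contradiction)
open import Relation.Nullary.Decidable using (_⊎-dec_; _×-dec_)

private
  variable
    S U : Apps
    G H : Graph
    α : Assignment
    f g : ℕ → ℕ

to-injective : (π : ℕ ↔ ℕ) {x y : ℕ} → Inverse.to π x ≡ Inverse.to π y → x ≡ y
to-injective π = Injection.injective (↔⇒↣ π)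

evalTerm-renameT : ∀ f α → evalTerm α ∘ renameT f ≗ evalTerm (α ∘ f)
evalTerm-renameT f α (var x)   = refl
evalTerm-renameT f α (const b) = refl

satApp-rename : ∀ f α a → satApp α (renameApp f a) ≡ satApp (α ∘ f) a
satApp-rename f α (app c zs) = cong (fn c) (begin
  Vec.map (evalTerm α) (Vec.map (renameT f) zs) ≡⟨ Vec.map-∘ (evalTerm α) (renameT f) zs ⟨
  Vec.map (evalTerm α ∘ renameT f) zs           ≡⟨ Vec.map-cong (evalTerm-renameT f α) zs ⟩
  Vec.map (evalTerm (α ∘ f)) zs                 ∎)
  where open ≡-Reasoning

Sat-rename⁻ : ∀ f S → Sat α (rename f S) → Sat (α ∘ f) S
Sat-rename⁻ {α} f S = All.map (λ {a} → trans (sym (satApp-rename f α a))) ∘ All.map⁻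

Sat-rename⁺ : ∀ f S → Sat (α ∘ f) S → Sat α (rename f S)
Sat-rename⁺ {α} f S = All.map⁺ ∘ All.map (λ {a} → trans (satApp-rename f α a))

renameT-∘ : ∀ f g → renameT g ∘ renameT f ≗ renameT (g ∘ f)
renameT-∘ f g (var x)   = refl
renameT-∘ f g (const b) = refl

rename-∘ : ∀ f g S → rename g (rename f S) ≡ rename (g ∘ f) S
rename-∘ f g S = begin
  List.map (renameApp g) (List.map (renameApp f) S) ≡⟨ List.map-∘ S ⟨
  List.map (renameApp g ∘ renameApp f) S            ≡⟨ List.map-cong renameApp-∘ S ⟩
  List.map (renameApp (g ∘ f)) S                    ∎
  where
  open ≡-Reasoning
  renameApp-∘ : renameApp g ∘ renameApp f ≗ renameApp (g ∘ f)
  renameApp-∘ (app c zs) = cong (app c)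
    (trans (sym (Vec.map-∘ (renameT g) (renameT f) zs)) (Vec.map-cong (renameT-∘ f g) zs))

rename-cong : f ≗ g → ∀ S → rename f S ≡ rename g S
rename-cong {f} {g} f≗g = List.map-cong renameApp-cong
  where
  renameT-cong : renameT f ≗ renameT g
  renameT-cong (var x)   = cong var (f≗g x)
  renameT-cong (const b) = refl
  renameApp-cong : renameApp f ≗ renameApp g
  renameApp-cong (app c zs) = cong (app c) (Vec.map-cong renameT-cong zs)

rename-id : ∀ S → rename id S ≡ S
rename-id S = trans (List.map-cong renameApp-id S) (List.map-id S)
  where
  renameT-id : renameT id ≗ id
  renameT-id (var x)   = refl
  renameT-id (const b) = refl
  renameApp-id : renameApp id ≗ id
  renameApp-id (app c zs) = cong (app c) (trans (Vec.map-cong renameT-id zs) (Vec.map-id zs))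

rename-mono : ∀ f → S ⇒ₗ U → rename f S ⇒ₗ rename f U
rename-mono {S} {U} f S⇒U α = Sat-rename⁺ f U ∘ S⇒U (α ∘ f) ∘ Sat-rename⁻ f S

⇒ₗ-preorder : Preorder _ _ _
⇒ₗ-preorder = record
  { Carrier    = Apps
  ; _≈_        = _≡_
  ; _≲_        = _⇒ₗ_
  ; isPreorder = record
    { isEquivalence = isEquivalence
    ; reflexive     = λ { refl α s → s }
    ; trans         = λ S⇒U U⇒W α → U⇒W α ∘ S⇒U α
    }
  }

module ⇒ₗ-Reasoning = Relation.Binary.Reasoning.Preorder ⇒ₗ-preorder

argVars : ∀ {n} → Vec Term n → List ℕ
argVars []             = []
argVars (var x ∷ zs)   = x ∷ argVars zs
argVars (const b ∷ zs) = argVars zs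

vars : Apps → List ℕ
vars []       = []
vars (a ∷ S) = argVars (args a) ++ vars S

Occurs⇒∈vars : ∀ {x} S → Occurs x S → x ∈ vars S
Occurs⇒∈vars (a ∷ S) (here x∈a)  = ∈-++⁺ˡ (occurs⇒∈argVars (args a) x∈a)
  where
  occurs⇒∈argVars : ∀ {n x} (zs : Vec Term n) → VAny.Any (OccursT x) zs → x ∈ argVars zs
  occurs⇒∈argVars (var y ∷ zs)   (VAny.here refl) = here refl
  occurs⇒∈argVars (var y ∷ zs)   (VAny.there p)   = there (occurs⇒∈argVars zs p)
  occurs⇒∈argVars (const b ∷ zs) (VAny.there p)   = occurs⇒∈argVars zs p
Occurs⇒∈vars (a ∷ S) (there x∈S) = ∈-++⁺ʳ (argVars (args a)) (Occurs⇒∈vars S x∈S)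

PermOf⇒from-fixes : ((π , _) : PermOf S U) → ∀ x → ¬ Occurs x (U ++ S) → Inverse.from π x ≡ x
PermOf⇒from-fixes {S} {U} (π , π-fixes) x x∉ =
  trans (cong from (sym (π-fixes x (x∉ ∘ Any.++-comm S U)))) (strictlyInverseʳ x)
  where open Inverse π

_^_ : (ℕ → ℕ) → ℕ → ℕ → ℕ
(f ^ n) x = fold x f n

^-injective : (∀ {x y} → f x ≡ f y → x ≡ y) → ∀ n {x y} → (f ^ n) x ≡ (f ^ n) y → x ≡ y
^-injective f-inj zero    eq = eq
^-injective f-inj (suc n) eq = ^-injective f-inj n (f-inj eq)

^-fixed : ∀ f {x} → f x ≡ x → ∀ n → (f ^ n) x ≡ x
^-fixed f fx≡x zero    = refl
^-fixed f fx≡x (suc n) = trans (cong f (^-fixed f fx≡x n)) fx≡x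

^-*-fixed : ∀ f {x} p → (f ^ p) x ≡ x → ∀ q → (f ^ (q * p)) x ≡ x
^-*-fixed f     p fᵖx≡x zero    = refl
^-*-fixed f {x} p fᵖx≡x (suc q) = begin
  (f ^ (p + q * p)) x       ≡⟨ fold-+ x f p ⟩
  (f ^ p) ((f ^ (q * p)) x) ≡⟨ cong (f ^ p) (^-*-fixed f p fᵖx≡x q) ⟩
  (f ^ p) x                 ≡⟨ fᵖx≡x ⟩
  x                         ∎
  where open ≡-Reasoning

module FiniteOrder {τ : ℕ → ℕ} (τ-injective : ∀ {x y} → τ x ≡ τ y → x ≡ y)
                   (L : List ℕ) (τ-fixes : ∀ {x} → x ∉ L → τ x ≡ x) where

  τ-preserves : ∀ {x} → x ∈ L → τ x ∈ L
  τ-preserves {x} x∈L with τ x ∈? L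
  ... | yes τx∈L = τx∈L
  ... | no  τx∉L = contradiction (subst (_∈ L) (sym (τ-injective (τ-fixes τx∉L))) x∈L) τx∉L

  ^-preserves : ∀ n {x} → x ∈ L → (τ ^ n) x ∈ L
  ^-preserves zero    x∈L = x∈L
  ^-preserves (suc n) x∈L = τ-preserves (^-preserves n x∈L)

  -- Among τ⁰ x, …, τ^|L| x ∈ L two coincide, and injectivity cancels the smaller power.
  period : ∀ {x} → x ∈ L → ∃ λ k → (τ ^ suc k) x ≡ x
  period {x} x∈L with pigeonhole (n<1+n (length L)) (λ i → index (^-preserves (toℕ i) x∈L))
  ... | i , j , i<j , same-index with m≤n⇒∃[o]m+o≡n i<j
  ... | k , i+1+k≡j = k , ^-injective τ-injective (toℕ i) (begin
    (τ ^ toℕ i) ((τ ^ suc k) x) ≡⟨ fold-+ x τ (toℕ i) ⟨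
    (τ ^ (toℕ i + suc k)) x     ≡⟨ cong (λ n → (τ ^ n) x) (trans (+-suc (toℕ i) k) i+1+k≡j) ⟩
    (τ ^ toℕ j) x               ≡⟨ index-injective (setoid ℕ) (^-preserves (toℕ i) x∈L)
                                     (^-preserves (toℕ j) x∈L) same-index ⟨
    (τ ^ toℕ i) x               ∎)
    where open ≡-Reasoning

  common-period : ∀ xs → (∀ {x} → x ∈ xs → ∃ λ k → (τ ^ suc k) x ≡ x) →
                  ∃ λ m → ∀ {x} → x ∈ xs → (τ ^ suc m) x ≡ x
  common-period []       _      = 0 , λ ()
  common-period (y ∷ ys) period-of
    with period-of (here refl) | common-period ys (period-of ∘ there)
  ... | k , τᵏ⁺¹y≡y | m , τᵐ⁺¹ys≡ys = m + k * suc m , divides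
    where
    divides : ∀ {x} → x ∈ y ∷ ys → (τ ^ (suc k * suc m)) x ≡ x
    divides (here refl) = subst (λ n → (τ ^ n) y ≡ y) (*-comm (suc m) (suc k))
                                (^-*-fixed τ (suc k) τᵏ⁺¹y≡y (suc m))
    divides (there x∈ys) = ^-*-fixed τ (suc m) (τᵐ⁺¹ys≡ys x∈ys) (suc k)

  finite-order : ∃ λ m → ∀ x → (τ ^ suc m) x ≡ x
  finite-order with common-period L period
  ... | m , τᵐ⁺¹L≡L = m , fixes
    where
    fixes : ∀ x → (τ ^ suc m) x ≡ x
    fixes x with x ∈? L
    ... | yes x∈L = τᵐ⁺¹L≡L x∈L
    ... | no  x∉L = ^-fixed τ (τ-fixes x∉L) (suc m)

rename-^-⇒ : ∀ τ → rename τ S ⇒ₗ S → ∀ k → rename (τ ^ k) S ⇒ₗ S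
rename-^-⇒ {S} τ τS⇒S zero    = Preorder.reflexive ⇒ₗ-preorder (rename-id S)
rename-^-⇒ {S} τ τS⇒S (suc k) = begin
  rename (τ ^ suc k) S        ≡⟨ rename-∘ (τ ^ k) τ S ⟨
  rename τ (rename (τ ^ k) S) ≲⟨ rename-mono τ (rename-^-⇒ τ τS⇒S k) ⟩
  rename τ S                  ≲⟨ τS⇒S ⟩
  S                           ∎
  where open ⇒ₗ-Reasoning

rename-periodic-reverse : ∀ τ m → (∀ x → (τ ^ suc m) x ≡ x) → rename τ S ⇒ₗ S → S ⇒ₗ rename τ S
rename-periodic-reverse {S} τ m τᵐ⁺¹≗id τS⇒S = begin
  S                           ≡⟨ rename-id S ⟨
  rename id S                 ≡⟨ rename-cong τᵐ⁺¹≗id S ⟨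
  rename (τ ^ suc m) S        ≡⟨ rename-∘ (τ ^ m) τ S ⟨
  rename τ (rename (τ ^ m) S) ≲⟨ rename-mono τ (rename-^-⇒ τ τS⇒S m) ⟩
  rename τ S                  ∎
  where open ⇒ₗ-Reasoning

iso⇒isoImplies : IsoApps S U → IsoImplies S U × IsoImplies U S
iso⇒isoImplies {S} {U} (p@(π , _) , πS≡U) =
  (p , λ α → proj₁ (πS≡U α)) , ((↔-sym π , PermOf⇒from-fixes {S} {U} p) , U⇒π⁻¹S)
  where
  open Inverse π
  U⇒π⁻¹S : rename from U ⇒ₗ S
  U⇒π⁻¹S = begin
    rename from U             ≲⟨ rename-mono from (λ α → proj₂ (πS≡U α)) ⟩
    rename from (rename to S) ≡⟨ rename-∘ to from S ⟩
    rename (from ∘ to) S      ≡⟨ rename-cong strictlyInverseʳ S ⟩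
    rename id S               ≡⟨ rename-id S ⟩
    S                         ∎
    where open ⇒ₗ-Reasoning

isoImplies⇒iso : IsoImplies S U × IsoImplies U S → IsoApps S U
isoImplies⇒iso {S} {U} (((π , π-fixes) , πS⇒U) , ((σ , σ-fixes) , σU⇒S)) =
  (π , π-fixes) , λ α → πS⇒U α , U⇒πS α
  where
  module π = Inverse π
  module σ = Inverse σ
  τ : ℕ → ℕ
  τ = σ.to ∘ π.to
  τS⇒S : rename τ S ⇒ₗ S
  τS⇒S = begin
    rename τ S                  ≡⟨ rename-∘ π.to σ.to S ⟨
    rename σ.to (rename π.to S) ≲⟨ rename-mono σ.to πS⇒U ⟩
    rename σ.to U               ≲⟨ σU⇒S ⟩
    S                           ∎
    where open ⇒ₗ-Reasoning
  τ-fixes : ∀ {x} → x ∉ vars (S ++ U) → τ x ≡ x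
  τ-fixes {x} x∉ = trans (cong σ.to (π-fixes x x∉SU)) (σ-fixes x (x∉SU ∘ Any.++-comm U S))
    where
    x∉SU : ¬ Occurs x (S ++ U)
    x∉SU = x∉ ∘ Occurs⇒∈vars (S ++ U)
  τ-injective : ∀ {x y} → τ x ≡ τ y → x ≡ y
  τ-injective = to-injective π ∘ to-injective σ
  S⇒τS : S ⇒ₗ rename τ S
  S⇒τS with FiniteOrder.finite-order τ-injective (vars (S ++ U)) τ-fixes
  ... | m , τᵐ⁺¹≗id = rename-periodic-reverse τ m τᵐ⁺¹≗id τS⇒S
  U⇒πS : U ⇒ₗ rename π.to S
  U⇒πS = begin
    U                             ≡⟨ rename-id U ⟨
    rename id U                   ≡⟨ rename-cong σ.strictlyInverseʳ U ⟨
    rename (σ.from ∘ σ.to) U      ≡⟨ rename-∘ σ.to σ.from U ⟨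
    rename σ.from (rename σ.to U) ≲⟨ rename-mono σ.from σU⇒S ⟩
    rename σ.from S               ≲⟨ rename-mono σ.from S⇒τS ⟩
    rename σ.from (rename τ S)    ≡⟨ rename-∘ τ σ.from S ⟩
    rename (σ.from ∘ τ) S         ≡⟨ rename-cong (σ.strictlyInverseʳ ∘ π.to) S ⟩
    rename π.to S                 ∎
    where open ⇒ₗ-Reasoning

Covers : Assignment → Graph → Set
Covers β G = All (λ e → β (proj₁ e) ∨ β (proj₂ e) ≡ true) (E G)

Sat⇒Covers : ∀ {β} G → Sat β S[ G ] → Covers β G
Sat⇒Covers G = All.map⁻

Covers⇒Sat : ∀ {β} G → Covers β G → Sat β S[ G ]
Covers⇒Sat G = All.map⁺

Covers-Adj : ∀ {β i j} → Covers β G → Adj G i j → β i ∨ β j ≡ true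
Covers-Adj         covers (inj₁ ij∈E) = All.lookup covers ij∈E
Covers-Adj {β = β} covers (inj₂ ji∈E) = trans (∨-comm (β _) (β _)) (All.lookup covers ji∈E)

Adj-sym : ∀ {i j} → Adj G i j → Adj G j i
Adj-sym = Data.Sum.swap

Adj⇒∈V : ∀ {i j} → Adj G i j → i ∈ V G × j ∈ V G
Adj⇒∈V {G} (inj₁ ij∈E) = All.lookup (edgesInV G) ij∈E
Adj⇒∈V {G} (inj₂ ji∈E) = Data.Product.swap (All.lookup (edgesInV G) ji∈E)

Adj? : ∀ G i j → Dec (Adj G i j)
Adj? G i j = ((i , j) ∈ₑ? E G) ⊎-dec ((j , i) ∈ₑ? E G)

∈V⇒Occurs : ∀ G → NoIsolated G → ∀ {v} → v ∈ V G → Occurs v S[ G ]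
∈V⇒Occurs G G-noIso v∈V with G-noIso _ v∈V
... | _ , inj₁ vu∈E = Any.map⁺ (lose vu∈E (VAny.here refl))
... | _ , inj₂ uv∈E = Any.map⁺ (lose uv∈E (VAny.there (VAny.here refl)))

transpose : ℕ → ℕ → ℕ → ℕ
transpose a b x with x ≟ a
... | yes _ = b
... | no _ with x ≟ b
...   | yes _ = a
...   | no _  = x

transpose-left : ∀ a b → transpose a b a ≡ b
transpose-left a b with a ≟ a
... | yes _   = refl
... | no a≢a = contradiction refl a≢a

transpose-right : ∀ a b → transpose a b b ≡ a
transpose-right a b with b ≟ a
... | yes b≡a = b≡a
... | no _ with b ≟ b
...   | yes _   = refl
...   | no b≢b = contradiction refl b≢b

transpose-other : ∀ {a b x} → x ≢ a → x ≢ b → transpose a b x ≡ x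
transpose-other {a} {b} {x} x≢a x≢b with x ≟ a
... | yes x≡a = contradiction x≡a x≢a
... | no _ with x ≟ b
...   | yes x≡b = contradiction x≡b x≢b
...   | no _    = refl

transpose-involutive : ∀ a b x → transpose a b (transpose a b x) ≡ x
transpose-involutive a b x with x ≟ a
... | yes refl = transpose-right x b
... | no x≢a with x ≟ b
...   | yes refl = transpose-left a x
...   | no x≢b   = transpose-other x≢a x≢b

transpose-∈ : ∀ {a b x} {L : List ℕ} → a ∈ L → b ∈ L → x ∈ L → transpose a b x ∈ L
transpose-∈ {a} {b} {x} a∈L b∈L x∈L with x ≟ a
... | yes _ = b∈L
... | no _ with x ≟ b
...   | yes _ = a∈L
...   | no _  = x∈L

transposition : ℕ → ℕ → ℕ ↔ ℕ
transposition a b =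
  mk↔ₛ′ (transpose a b) (transpose a b) (transpose-involutive a b) (transpose-involutive a b)

record PermExtension (f : ℕ → ℕ) (xs L : List ℕ) : Set where
  field
    perm      : ℕ ↔ ℕ
    agrees    : ∀ {u} → u ∈ xs → Inverse.to perm u ≡ f u
    fixes     : ∀ {x} → x ∉ L → Inverse.to perm x ≡ x
    preserves : ∀ {x} → x ∈ L → Inverse.to perm x ∈ L

-- Given ρ agreeing with f on xs, composing with the transposition of ρ v and f v also
-- makes it agree on v, without disturbing xs by injectivity of f and of ρ.
extend : ∀ f xs {L} → (∀ {u} → u ∈ xs → u ∈ L) → (∀ {u} → u ∈ xs → f u ∈ L) →
         (∀ {u v} → u ∈ xs → v ∈ xs → f u ≡ f v → u ≡ v) → PermExtension f xs L
extend f []       _    _     _     = record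
  { perm = ↔-refl ; agrees = λ () ; fixes = λ _ → refl ; preserves = id }
extend f (v ∷ xs) {L} xs⊆L f[xs]⊆L f-inj = record
  { perm      = ↔-trans ρ (transposition p q)
  ; agrees    = agrees′
  ; fixes     = λ {x} x∉L → trans (cong (transpose p q) (fixes x∉L))
                  (transpose-other (λ x≡p → x∉L (subst (_∈ L) (sym x≡p) p∈L))
                                   (λ x≡q → x∉L (subst (_∈ L) (sym x≡q) q∈L)))
  ; preserves = transpose-∈ p∈L q∈L ∘ preserves
  }
  where
  open PermExtension (extend f xs (xs⊆L ∘ there) (f[xs]⊆L ∘ there)
                                  (λ u∈ v∈ → f-inj (there u∈) (there v∈)))
    renaming (perm to ρ)
  p = Inverse.to ρ v
  q = f v
  p∈L : p ∈ L
  p∈L = preserves (xs⊆L (here refl))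
  q∈L : q ∈ L
  q∈L = f[xs]⊆L (here refl)
  agrees′ : ∀ {u} → u ∈ v ∷ xs → transpose p q (Inverse.to ρ u) ≡ f u
  agrees′ (here refl) = transpose-left p q
  agrees′ {u} (there u∈xs) with u ≟ v
  ... | yes refl = transpose-left p q
  ... | no u≢v  = trans (cong (transpose p q) (agrees u∈xs))
                    (transpose-other (λ fu≡p → u≢v (to-injective ρ (trans (agrees u∈xs) fu≡p)))
                                     (λ fu≡q → u≢v (f-inj (there u∈xs) (here refl) fu≡q)))

subgraph⇒isoImplies : ∀ G H → NoIsolated G → NoIsolated H →
                      ContainsSubgraph G H → IsoImplies S[ G ] S[ H ]
subgraph⇒isoImplies G H G-noIso H-noIso (G' , V'⊆V , E'⊆E , f , g , f∈ , g∈ , gf , fg , f-adj) =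
  (perm , fixes-outside) , ρG⇒H
  where
  L = V G' ++ V H
  open PermExtension (extend f (V G') ∈-++⁺ˡ (∈-++⁺ʳ (V G') ∘ f∈ _)
                        (λ {u} {v} u∈ v∈ fu≡fv →
                           trans (sym (gf u u∈)) (trans (cong g fu≡fv) (gf v v∈))))
  open Inverse perm using (to)
  fixes-outside : ∀ x → ¬ Occurs x (S[ G ] ++ S[ H ]) → to x ≡ x
  fixes-outside x x∉ = fixes λ x∈L → x∉ ([ Any.++⁺ˡ ∘ ∈V⇒Occurs G G-noIso ∘ V'⊆V x
                                          , Any.++⁺ʳ S[ G ] ∘ ∈V⇒Occurs H H-noIso
                                          ]′ (∈-++⁻ (V G') x∈L))
  ρG⇒H : rename to S[ G ] ⇒ₗ S[ H ]
  ρG⇒H α sat = Covers⇒Sat {α} H (All.tabulate covered)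
    where
    covers : Covers (α ∘ to) G
    covers = Sat⇒Covers {α ∘ to} G (Sat-rename⁻ to S[ G ] sat)
    covered : ∀ {e} → e ∈ E H → α (proj₁ e) ∨ α (proj₂ e) ≡ true
    covered {a , b} ab∈E =
      subst₂ (λ x y → α x ∨ α y ≡ true) (to∘g≡id a∈V) (to∘g≡id b∈V)
             (Covers-Adj {G} {α ∘ to} covers ga~gb)
      where
      a∈V = proj₁ (All.lookup (edgesInV H) ab∈E)
      b∈V = proj₂ (All.lookup (edgesInV H) ab∈E)
      to∘g≡id : ∀ {w} → w ∈ V H → to (g w) ≡ w
      to∘g≡id w∈V = trans (agrees (g∈ _ w∈V)) (fg _ w∈V)
      fga~fgb : Adj H (f (g a)) (f (g b))
      fga~fgb = subst₂ (Adj H) (sym (fg a a∈V)) (sym (fg b b∈V)) (inj₁ ab∈E)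
      ga~gb : Adj G (g a) (g b)
      ga~gb = E'⊆E (g a) (g b) (proj₂ (f-adj (g a) (g b) (g∈ a a∈V) (g∈ b b∈V)) fga~fgb)

falseOn : ℕ → ℕ → Assignment
falseOn a b y with y ≟ a | y ≟ b
... | yes _ | _     = false
... | no _  | yes _ = false
... | no _  | no _  = true

falseOn-left : ∀ a b → falseOn a b a ≡ false
falseOn-left a b with a ≟ a
... | yes _    = refl
... | no  a≢a = contradiction refl a≢a

falseOn-right : ∀ a b → falseOn a b b ≡ false
falseOn-right a b with b ≟ a | b ≟ b
... | yes _ | _       = refl
... | no _  | yes _   = refl
... | no _  | no  b≢b = contradiction refl b≢b

falseOn-false : ∀ {a b y} → falseOn a b y ≡ false → y ≡ a ⊎ y ≡ b
falseOn-false {a} {b} {y} eq with y ≟ a | y ≟ b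
... | yes y≡a | _       = inj₁ y≡a
... | no _    | yes y≡b = inj₂ y≡b
falseOn-false () | no _ | no _

falseOn-uncovers : ∀ {a b} → Adj H a b → ¬ Covers (falseOn a b) H
falseOn-uncovers {H} {a} {b} ab covers
  with trans (sym (cong₂ _∨_ (falseOn-left a b) (falseOn-right a b)))
             (Covers-Adj {H} {falseOn a b} covers ab)
... | ()

∨-true : ∀ x y → ¬ (x ≡ false × y ≡ false) → x ∨ y ≡ true
∨-true true  _     _            = refl
∨-true false true  _            = refl
∨-true false false not-both = contradiction (refl , refl) not-both

module Embedding (G H : Graph) (π : ℕ ↔ ℕ) (πG⇒H : rename (Inverse.to π) S[ G ] ⇒ₗ S[ H ]) where
  open Inverse π

  edge-lifts : ∀ {a b} → Adj H a b → ∃₂ λ i j → Adj G i j × to i ≡ a × to j ≡ b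
  edge-lifts {a} {b} ab with any? (λ e → (β (proj₁ e) ≟ᵇ false) ×-dec (β (proj₂ e) ≟ᵇ false)) (E G)
    where β = falseOn a b ∘ to
  ... | no none = ⊥-elim (falseOn-uncovers {H} ab (Sat⇒Covers {falseOn a b} H
        (πG⇒H _ (Sat-rename⁺ to S[ G ] (Covers⇒Sat {falseOn a b ∘ to} G
          (All.map (∨-true _ _) (All.¬Any⇒All¬ (E G) none)))))))
  ... | yes some with find some
  ... | (i , j) , ij∈E , (i-false , j-false) with falseOn-false i-false | falseOn-false j-false
  ... | inj₁ i↦a | inj₂ j↦b = i , j , inj₁ ij∈E , i↦a , j↦b
  ... | inj₂ i↦b | inj₁ j↦a = j , i , inj₂ ij∈E , j↦a , i↦b
  ... | inj₁ i↦a | inj₁ j↦a = contradiction (to-injective π (trans i↦a (sym j↦a)))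
                                             (All.lookup (loopless G) ij∈E)
  ... | inj₂ i↦b | inj₂ j↦b = contradiction (to-injective π (trans i↦b (sym j↦b)))
                                             (All.lookup (loopless G) ij∈E)

  maps-to-edge? : (e : ℕ × ℕ) → Dec (Adj H (to (proj₁ e)) (to (proj₂ e)))
  maps-to-edge? e = Adj? H (to (proj₁ e)) (to (proj₂ e))

  preimage-∈ : ∀ {v} → to v ∈ V H → v ∈ List.map from (V H)
  preimage-∈ {v} tov∈V = subst (_∈ List.map from (V H)) (strictlyInverseʳ v) (∈-map⁺ from tov∈V)

  preimage : Graph
  preimage = record
    { V        = List.map from (V H)
    ; E        = filter maps-to-edge? (E G)
    ; edgesInV = All.tabulate λ ij∈E' →
        let ij↦E = proj₂ (∈-filter⁻ maps-to-edge? {xs = E G} ij∈E')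
        in preimage-∈ (proj₁ (Adj⇒∈V {H} ij↦E)) , preimage-∈ (proj₂ (Adj⇒∈V {H} ij↦E))
    ; loopless = All.tabulate λ ij∈E' →
        All.lookup (loopless G) (proj₁ (∈-filter⁻ maps-to-edge? {xs = E G} ij∈E'))
    }

  preimage-Adj⁻ : ∀ {i j} → Adj preimage i j → Adj G i j × Adj H (to i) (to j)
  preimage-Adj⁻ (inj₁ ij∈E') = Data.Product.map₁ inj₁ (∈-filter⁻ maps-to-edge? {xs = E G} ij∈E')
  preimage-Adj⁻ (inj₂ ji∈E') =
    Data.Product.map inj₂ (Adj-sym {H}) (∈-filter⁻ maps-to-edge? {xs = E G} ji∈E')

  preimage-Adj⁺ : ∀ {u v} → Adj H (to u) (to v) → Adj preimage u v
  preimage-Adj⁺ {u} {v} uv↦E with edge-lifts uv↦E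
  ... | i , j , inj₁ ij∈E , i↦u , j↦v with to-injective π i↦u | to-injective π j↦v
  ... | refl | refl = inj₁ (∈-filter⁺ maps-to-edge? ij∈E uv↦E)
  preimage-Adj⁺ uv↦E | i , j , inj₂ ji∈E , i↦u , j↦v
    with to-injective π i↦u | to-injective π j↦v
  ... | refl | refl = inj₂ (∈-filter⁺ maps-to-edge? ji∈E (Adj-sym {H} uv↦E))

  preimage-⊆ : NoIsolated H → ∀ v → v ∈ V preimage → v ∈ V G
  preimage-⊆ H-noIso v v∈V' with ∈-map⁻ from v∈V'
  ... | w , w∈V , refl with H-noIso w w∈V
  ... | _ , wu∈E with edge-lifts wu∈E
  ... | i , _ , ij∈E , i↦w , _ =
    subst (_∈ V G) (trans (sym (strictlyInverseʳ i)) (cong from i↦w)) (proj₁ (Adj⇒∈V {G} ij∈E))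

  to-∈ : ∀ v → v ∈ V preimage → to v ∈ V H
  to-∈ v v∈V' with ∈-map⁻ from v∈V'
  ... | w , w∈V , refl = subst (_∈ V H) (sym (strictlyInverseˡ w)) w∈V

  contains : NoIsolated H → ContainsSubgraph G H
  contains H-noIso = preimage , preimage-⊆ H-noIso , (λ _ _ → proj₁ ∘ preimage-Adj⁻)
    , to , from , to-∈ , (λ w → ∈-map⁺ from)
    , (λ v _ → strictlyInverseʳ v) , (λ w _ → strictlyInverseˡ w)
    , λ u v _ _ → proj₂ ∘ preimage-Adj⁻ , preimage-Adj⁺

isoImplies⇒subgraph : ∀ G H → NoIsolated H → IsoImplies S[ G ] S[ H ] → ContainsSubgraph G H
isoImplies⇒subgraph G H H-noIso ((π , _) , πG⇒H) = Embedding.contains G H π πG⇒H H-noIso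

mainTheorem2 : ((𝒞 : List Constraint) (S U : Apps) → AppsOf 𝒞 S → AppsOf 𝒞 U →
        IsoApps S U ⇔ (IsoImplies S U × IsoImplies U S))
    ×
    ((G H : Graph) → NoIsolated G → NoIsolated H →
        ContainsSubgraph G H ⇔ IsoImplies S[ G ] S[ H ])
mainTheorem2 =
  (λ _ _ _ _ _ → mk⇔ iso⇒isoImplies isoImplies⇒iso) ,
  (λ G H G-noIso H-noIso → mk⇔ (subgraph⇒isoImplies G H G-noIso H-noIso)
                                 (isoImplies⇒subgraph G H H-noIso))
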